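{- Let $\mathsf{X}$ be a finite connected graph without tails with $l$ ramified vertices, and suppose $\mathsf{X}$ has a segment decomposition with segments $\mathsf{S}^1,\dots,\mathsf{S}^k$. Let $\mathsf{T}$ be a spanning tree of $\mathsf{X}$ and put $\mathsf{T}^i=\mathsf{T}\cap\mathsf{S}^i$. Then the number of indices $i$ such that $\mathsf{S}^i$ is a 2-segment and $\mathsf{T}^i$ is a spanning tree of $\mathsf{S}^i$ is exactly $l-1$.
   Context: Graphs: finite vertex set, directed edges with origin/terminus and a fixed-point-free involution $e\mapsto\bar e$ reversing them; undirected edges are pairs $\{e,\bar e\}$; multiple edges and loops allowed. Some vertices are ramified (marked), the rest unramified. No tails: no unramified vertex has exactly one neighbour and is joined to it by exactly one edge. Segments: a path is a sequence of distinct vertices with distinct edges joining consecutive ones. An admissible path has two distinct ramified endpoints and only unramified interior vertices. For each pair $\{v,v'\}$ of distinct ramified vertices joined by an admissible path, the admissible paths between them are grouped into classes by the equivalence relation generated by sharing an edge; each class yields a 2-segment (subgraph of all vertices and edges of its paths; its ramified vertices are $v,v'$). $\mathsf{X}$ has a segment decomposition if (a) no two admissible paths joining different pairs of distinct ramified vertices share an edge, and (b) every edge in no 2-segment lies on a closed path at some ramified vertex $v$ (closed sequence $v=w_0,\dots,w_m=v$, $m\ge1$, distinct edges, $w_1,\dots,w_{m-1}$ distinct, unramified, in no 2-segment); for each $v$ such closed paths are grouped into classes by sharing an edge, each class giving a 1-segment. The segments $\mathsf{S}^1,\dots,\mathsf{S}^k$ are all these 1- and 2-segments; their edge sets partition the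 edges of $\mathsf{X}$. -}

module Defs where

open import Data.Nat using (ℕ; _∸_; _≥_)
open import Data.Fin using (Fin)
open import Data.Fin.Subset using (Subset; _∈_; _∩_; ∣_∣)
open import Data.List using (List; []; _∷_; length; map)
open import Data.List.Relation.Unary.All using (All)
open import Data.List.Relation.Unary.Any using (Any)
open import Data.List.Relation.Unary.AllPairs using (AllPairs)
open import Data.List.Relation.Unary.Unique.Propositional using (Unique)
open import Data.Product using (Σ; ∃; ∃-syntax; _×_; _,_; proj₁)
open import Data.Sum using (_⊎_)
open import Data.Unit using (⊤)
open import Relation.Binary.PropositionalEquality using (_≡_; _≢_)
open import Relation.Nullary using (¬_)
open import Relation.Binary.Construct.Closure.ReflexiveTransitive using (Star)

-- A finite graph in Serre's sense: vertices Fin nV, directed edges Fin nE,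
-- origin o, terminus t, fixed-point-free involution bar reversing edges.
record Graph : Set where
  field
    nV nE     : ℕ
    o t       : Fin nE → Fin nV
    bar       : Fin nE → Fin nE
    bar-invol : ∀ e → bar (bar e) ≡ e
    bar-fpf   : ∀ e → bar e ≢ e
    o-bar     : ∀ e → o (bar e) ≡ t e
    ramified  : Subset nV

module _ (G : Graph) where
  open Graph G

  Vtx : Set
  Vtx = Fin nV

  Edge : Set
  Edge = Fin nE

  Ram : Vtx → Set
  Ram v = v ∈ ramified

  Unram : Vtx → Set
  Unram v = ¬ (v ∈ ramified)

  numRam : ℕ
  numRam = ∣ ramified ∣

  -- e and e' represent the same undirected edge {e , bar e}
  SameEdge : Edge → Edge → Set
  SameEdge e e' = (e' ≡ e) ⊎ (e' ≡ bar e)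

  DistinctEdges : List Edge → Set
  DistinctEdges = AllPairs (λ e e' → ¬ SameEdge e e')

  EdgeOn : Edge → List Edge → Set
  EdgeOn e es = Any (SameEdge e) es

  Share : List Edge → List Edge → Set
  Share es es' = Any (λ x → EdgeOn x es') es

  data Chain : Vtx → List Edge → Vtx → Set where
    nil  : ∀ {v} → Chain v [] v
    cons : ∀ {v w e es} → o e ≡ v → Chain (t e) es w → Chain v (e ∷ es) w

  verts : Vtx → List Edge → List Vtx
  verts v es = v ∷ map t es

  inner : List Edge → List Vtx
  inner []             = []
  inner (e ∷ [])       = []
  inner (e ∷ e' ∷ es)  = t e ∷ inner (e' ∷ es)

  Path : Vtx → List Edge → Vtx → Set
  Path v es w = Chain v es w × Unique (verts v es) × DistinctEdges es

  Admissible : Vtx → List Edge → Vtx → Set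
  Admissible v es w =
    Path v es w × Ram v × Ram w × v ≢ w × All Unram (inner es)

  AdmPath : Vtx → Vtx → Set
  AdmPath v w = Σ (List Edge) (λ es → Admissible v es w)

  SameClass : ∀ {v w} → AdmPath v w → AdmPath v w → Set
  SameClass = Star (λ p q → Share (proj₁ p) (proj₁ q))

  -- A (as a set of directed edges) is the edge set of a 2-segment:
  -- the union of the edges of an equivalence class of admissible paths
  -- between two distinct ramified vertices v, w.
  Is2Seg : Subset nE → Set
  Is2Seg A = ∃[ v ] ∃[ w ] Σ (AdmPath v w) λ p → ∀ e →
    (e ∈ A → ∃[ q ] (SameClass p q × EdgeOn e (proj₁ q))) ×
    (∃[ q ] (SameClass p q × EdgeOn e (proj₁ q)) → e ∈ A)

  VertOf : Subset nE → Vtx → Set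
  VertOf A u = ∃[ e ] (e ∈ A × o e ≡ u)

  EdgeIn2Seg : Edge → Set
  EdgeIn2Seg e = ∃[ A ] (Is2Seg A × e ∈ A)

  VertIn2Seg : Vtx → Set
  VertIn2Seg u = ∃[ A ] (Is2Seg A × VertOf A u)

  SamePair : Vtx → Vtx → Vtx → Vtx → Set
  SamePair v w v' w' = (v ≡ v' × w ≡ w') ⊎ (v ≡ w' × w ≡ v')

  ClosedPath : Vtx → List Edge → Set
  ClosedPath v es =
    Chain v es v × length es ≥ 1 × DistinctEdges es × Unique (inner es) ×
    All (λ u → Unram u × ¬ VertIn2Seg u) (inner es)

  HasSegmentDecomposition : Set
  HasSegmentDecomposition =
    (∀ v w v' w' (p : AdmPath v w) (q : AdmPath v' w') →
       ¬ SamePair v w v' w' → ¬ Share (proj₁ p) (proj₁ q)) ×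
    (∀ e → ¬ EdgeIn2Seg e →
       ∃[ v ] (Ram v × ∃[ es ] (ClosedPath v es × EdgeOn e es)))

  -- no tails: no unramified vertex of valency one
  -- (exactly one directed edge with origin v)
  NoTails : Set
  NoTails = ∀ v → Unram v →
    ¬ (∃[ e ] (o e ≡ v × (∀ e' → o e' ≡ v → e' ≡ e)))

  Adj : Subset nE → Vtx → Vtx → Set
  Adj E a b = ∃[ e ] (e ∈ E × o e ≡ a × t e ≡ b)

  allEdges : Subset nE
  allEdges = Data.Fin.Subset.⊤

  Connected : Set
  Connected = Fin nV × (∀ u w → Star (Adj allEdges) u w)

  HasCycle : Subset nE → Set
  HasCycle E = ∃[ v ] ∃[ es ]
    (Chain v es v × length es ≥ 1 × All (_∈ E) es × DistinctEdges es ×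
     Unique (map t es))

  IsTree : (Vtx → Set) → Subset nE → Set
  IsTree V E =
    (∃[ u ] V u) ×
    (∀ e → e ∈ E → bar e ∈ E) ×
    (∀ e → e ∈ E → V (o e)) ×
    (∀ u w → V u → V w → Star (Adj E) u w) ×
    ¬ HasCycle E

  IsSpanningTree : Subset nE → Set
  IsSpanningTree T = IsTree (λ _ → ⊤) T

  HasCard : (Subset nE → Set) → ℕ → Set
  HasCard P k = Σ (Fin k → Subset nE) λ f →
    (∀ i j → f i ≡ f j → i ≡ j) ×
    (∀ i → P (f i)) ×
    (∀ A → P A → ∃[ i ] (f i ≡ A))

-- Root the spanning tree T at a ramified vertex r₀ and send every other ramified vertex v to the
-- 2-segment containing the first edge of the T-path from v to r₀. That edge cannot lie on a
-- 1-segment: a walk entering a closed path at v is trapped on closed paths at v until it returns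
-- to v. Inside a 2-segment every edge at an unramified vertex belongs to the segment, so the
-- T-path from v runs inside the segment until it reaches the other end: T joins the two ends
-- within the segment, and T ∩ S is a spanning tree of S. Conversely, if T ∩ S is a spanning tree
-- of S, the T-path to r₀ from one of its ends starts inside S, because in a tree two paths with
-- the same ends start with the same edge. The same fact shows that two ramified vertices are
-- never sent to the same segment. Hence the map is a bijection from the l − 1 ramified vertices
-- other than r₀ onto the segments counted.

module Submission where

open import Defs
open import Data.Bool using (true; false)
open import Data.Empty using (⊥; ⊥-elim)
open import Data.Fin as Fin using (Fin; punchIn; punchOut) renaming (_≟_ to _≟ᶠ_)
open import Data.Fin.Properties using (suc-injective; punchIn-injective; punchInᵢ≢i; punchIn-punchOut)
open import Data.Fin.Subset as Subset using (Subset; _∩_; inside; outside; ∣_∣) renaming (_∈_ to _∈ₛ_)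
open import Data.Fin.Subset.Properties
  using (x∈p∩q⁺; x∈p∩q⁻; ⊆-antisym; Empty-unique; ∣⊥∣≡0; nonempty?) renaming (_∈?_ to _∈ₛ?_)
open import Data.List using (List; []; _∷_; [_]; _++_; length; map; filter; concatMap; allFin; reverse)
open import Data.List.Properties using (filter-notAll; map-++; length-map; length-tabulate; ≡-dec; unfold-reverse)
open import Data.List.Relation.Unary.All as All using (All; []; _∷_; all?)
open import Data.List.Relation.Unary.All.Properties using (¬Any⇒All¬; ++⁺; ++⁻ˡ)
open import Data.List.Relation.Unary.Any as Any using (Any; here; there; any?)
open import Data.List.Relation.Unary.Any.Properties using (reverse⁻)
open import Data.List.Relation.Unary.AllPairs using ([]; _∷_; allPairs?)
open import Data.List.Relation.Unary.Unique.Propositional using (Unique)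
open import Data.List.Relation.Unary.Unique.Propositional.Properties using (Unique[x∷xs]⇒x∉xs)
open import Data.List.Relation.Binary.Subset.Propositional using (_⊆_)
open import Data.List.Relation.Binary.Permutation.Propositional using (↭⇒↭ₛ; ↭-sym)
open import Data.List.Relation.Binary.Permutation.Propositional.Properties using (↭-reverse)
open import Data.List.Membership.Propositional using (_∈_; _∉_; lose; find)
open import Data.List.Membership.Propositional.Properties
  using (∈-filter⁺; ∈-concatMap⁺; ∈-map⁺; ∈-map⁻; ∈-allFin; ∈-++⁺ˡ; ∈-++⁺ʳ; ∈-++⁻)
open import Data.Nat using (ℕ; zero; suc; _≤_; _∸_; z≤n; s≤s)
open import Data.Nat.Properties using (≤-trans; n≤1+n; module ≤-Reasoning)
open import Data.Product using (Σ; ∃; ∃₂; _×_; _,_; proj₁; proj₂)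
open import Data.Sum using (_⊎_; inj₁; inj₂; [_,_]′)
open import Data.Unit using (tt)
open import Function using (_∘_)
import Data.Vec as Vec
open import Relation.Binary using (Decidable; DecidableEquality)
open import Relation.Binary.Construct.Closure.ReflexiveTransitive as Star using (Star; ε; _◅_; _◅◅_)
open import Relation.Binary.PropositionalEquality
  using (_≡_; _≢_; refl; sym; trans; cong; cong₂; subst; ≢-sym; setoid; module ≡-Reasoning)
open import Relation.Nullary using (¬_; Dec; yes; no)
open import Relation.Nullary.Decidable using (map′; _⊎-dec_; _×-dec_; ¬?)

module _ {X : Set} (_≟_ : DecidableEquality X) where

  unique⊆⇒length≤ : {xs ys : List X} → Unique xs → xs ⊆ ys → length xs ≤ length ys
  unique⊆⇒length≤ {[]} _ _ = z≤n
  unique⊆⇒length≤ {x ∷ xs} {ys} (x∉xs ∷ u) xs⊆ys =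
    ≤-trans (s≤s (unique⊆⇒length≤ u xs⊆ys-x)) (filter-notAll (λ y → ¬? (y ≟ x)) ys x∈ys)
    where
    xs⊆ys-x : xs ⊆ filter (λ y → ¬? (y ≟ x)) ys
    xs⊆ys-x y∈xs = ∈-filter⁺ (λ y → ¬? (y ≟ x)) (xs⊆ys (there y∈xs)) λ y≡x → All.lookup x∉xs y∈xs (sym y≡x)
    x∈ys : Any (λ y → ¬ ¬ (y ≡ x)) ys
    x∈ys = Any.map (λ y≡x ¬y≡x → ¬y≡x (sym y≡x)) (xs⊆ys (here refl))

listsUpTo : {m : ℕ} → ℕ → List (List (Fin m))
listsUpTo zero = [ [] ]
listsUpTo {m} (suc k) = [] ∷ concatMap (λ x → map (x ∷_) (listsUpTo k)) (allFin m)

∈-listsUpTo : {m : ℕ} (k : ℕ) (xs : List (Fin m)) → length xs ≤ k → xs ∈ listsUpTo k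
∈-listsUpTo zero [] _ = here refl
∈-listsUpTo (suc k) [] _ = here refl
∈-listsUpTo (suc k) (x ∷ xs) (s≤s len≤k) =
  there (∈-concatMap⁺ (λ y → map (y ∷_) (listsUpTo k))
           (lose (∈-allFin x) (∈-map⁺ (x ∷_) (∈-listsUpTo k xs len≤k))))

-- A relation whose targets all lie in a fixed finite list has decidable
-- reflexive-transitive closure: a shortest witness visits each target once.
module FiniteReachability {X : Set} (_≟_ : DecidableEquality X) {R : X → X → Set} (R? : Decidable R)
  (targets : List X) (target∈ : ∀ {x y} → R x y → y ∈ targets) where

  open import Data.List.Membership.DecPropositional _≟_ using (_∈?_)

  data Walk : X → List X → X → Set where
    []  : ∀ {x} → Walk x [] x
    _∷_ : ∀ {x z zs y} → R x z → Walk z zs y → Walk x (z ∷ zs) y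

  ReachWithin : ℕ → X → X → Set
  ReachWithin zero x y = x ≡ y
  ReachWithin (suc n) x y = x ≡ y ⊎ Any (λ z → R x z × ReachWithin n z y) targets

  reachWithin? : ∀ n → Decidable (ReachWithin n)
  reachWithin? zero x y = x ≟ y
  reachWithin? (suc n) x y = (x ≟ y) ⊎-dec any? (λ z → R? x z ×-dec reachWithin? n z y) targets

  reachWithin⇒star : ∀ n {x y} → ReachWithin n x y → Star R x y
  reachWithin⇒star zero refl = ε
  reachWithin⇒star (suc n) (inj₁ refl) = ε
  reachWithin⇒star (suc n) (inj₂ step) with Any.satisfied step
  ... | _ , xRz , rest = xRz ◅ reachWithin⇒star n rest

  walk⇒reachWithin : ∀ {x zs y} n → Walk x zs y → length zs ≤ n → ReachWithin n x y
  walk⇒reachWithin zero [] _ = refl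
  walk⇒reachWithin (suc n) [] _ = inj₁ refl
  walk⇒reachWithin (suc n) (xRz ∷ w) (s≤s len≤n) = inj₂ (lose (target∈ xRz) (xRz , walk⇒reachWithin n w len≤n))

  star⇒walk : ∀ {x y} → Star R x y → ∃ λ zs → Walk x zs y
  star⇒walk ε = _ , []
  star⇒walk (xRz ◅ s) = _ , xRz ∷ proj₂ (star⇒walk s)

  walk⊆targets : ∀ {x zs y} → Walk x zs y → zs ⊆ targets
  walk⊆targets (xRz ∷ w) (here refl) = target∈ xRz
  walk⊆targets (xRz ∷ w) (there z∈zs) = walk⊆targets w z∈zs

  UniqueWalk : X → X → Set
  UniqueWalk x y = ∃ λ zs → Walk x zs y × Unique (x ∷ zs)

  dropUntil : ∀ {x z zs y} → x ∈ (z ∷ zs) → Walk z zs y → Unique (z ∷ zs) → UniqueWalk x y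
  dropUntil (here refl) w u = _ , w , u
  dropUntil (there x∈zs) (_ ∷ w) (_ ∷ u) = dropUntil x∈zs w u

  shortcut : ∀ {x zs y} → Walk x zs y → UniqueWalk x y
  shortcut [] = [] , [] , [] ∷ []
  shortcut {x} (_∷_ {z = z} xRz w) with shortcut w
  ... | zs , w′ , u with x ∈? (z ∷ zs)
  ... | yes x∈ = dropUntil x∈ w′ u
  ... | no x∉ = z ∷ zs , xRz ∷ w′ , ¬Any⇒All¬ _ x∉ ∷ u

  star⇒reachWithin : ∀ {x y} → Star R x y → ReachWithin (length targets) x y
  star⇒reachWithin s with shortcut (proj₂ (star⇒walk s))
  ... | zs , w , _ ∷ u = walk⇒reachWithin (length targets) w (unique⊆⇒length≤ _≟_ u (walk⊆targets w))

  star? : Decidable (Star R)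
  star? x y = map′ (reachWithin⇒star (length targets)) star⇒reachWithin (reachWithin? (length targets) x y)

decToSubset : ∀ {n} {P : Fin n → Set} → (∀ i → Dec (P i)) → Subset n
decToSubset {zero} P? = Vec.[]
decToSubset {suc n} P? = side (P? Fin.zero) Vec.∷ decToSubset (λ i → P? (Fin.suc i))
  where
  side : ∀ {A} → Dec A → Subset.Side
  side (yes _) = inside
  side (no _) = outside

∈-decToSubset⁺ : ∀ {n} {P : Fin n → Set} (P? : ∀ i → Dec (P i)) {i} → P i → i ∈ₛ decToSubset P?
∈-decToSubset⁺ {suc n} P? {Fin.zero} p with P? Fin.zero
... | yes _ = Vec.here
... | no ¬p = ⊥-elim (¬p p)
∈-decToSubset⁺ {suc n} P? {Fin.suc i} p = Vec.there (∈-decToSubset⁺ (λ j → P? (Fin.suc j)) p)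

∈-decToSubset⁻ : ∀ {n} {P : Fin n → Set} (P? : ∀ i → Dec (P i)) {i} → i ∈ₛ decToSubset P? → P i
∈-decToSubset⁻ {suc n} P? {Fin.zero} i∈ with P? Fin.zero | i∈
... | yes p | _ = p
∈-decToSubset⁻ {suc n} P? {Fin.suc i} (Vec.there i∈) = ∈-decToSubset⁻ (λ j → P? (Fin.suc j)) i∈

module _ {X : Set} {a b : X} where

  distinct-ends-cover : ∀ {x y z} → x ≡ a ⊎ x ≡ b → y ≡ a ⊎ y ≡ b → x ≢ y → z ≡ a ⊎ z ≡ b → z ≡ x ⊎ z ≡ y
  distinct-ends-cover (inj₁ refl) (inj₁ refl) x≢y _ = ⊥-elim (x≢y refl)
  distinct-ends-cover (inj₂ refl) (inj₂ refl) x≢y _ = ⊥-elim (x≢y refl)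
  distinct-ends-cover (inj₁ refl) (inj₂ refl) _ z-end = z-end
  distinct-ends-cover (inj₂ refl) (inj₁ refl) _ z-end = [ inj₂ , inj₁ ]′ z-end

  module _ {R : X → X → Set} (sym-R : ∀ {x y} → R x y → R y x) where

    ends-linked : Star R a b → ∀ {x y} → x ≡ a ⊎ x ≡ b → y ≡ a ⊎ y ≡ b → Star R x y
    ends-linked a↝b (inj₁ refl) (inj₁ refl) = ε
    ends-linked a↝b (inj₁ refl) (inj₂ refl) = a↝b
    ends-linked a↝b (inj₂ refl) (inj₁ refl) = Star.reverse sym-R a↝b
    ends-linked a↝b (inj₂ refl) (inj₂ refl) = ε

    distinct-ends-linked : ∀ {x y} → x ≡ a ⊎ x ≡ b → y ≡ a ⊎ y ≡ b → x ≢ y → Star R x y → Star R a b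
    distinct-ends-linked (inj₁ refl) (inj₂ refl) _ x↝y = x↝y
    distinct-ends-linked (inj₂ refl) (inj₁ refl) _ x↝y = Star.reverse sym-R x↝y
    distinct-ends-linked (inj₁ refl) (inj₁ refl) x≢y _ = ⊥-elim (x≢y refl)
    distinct-ends-linked (inj₂ refl) (inj₂ refl) x≢y _ = ⊥-elim (x≢y refl)

enumerate : ∀ {n} (p : Subset n) → Fin ∣ p ∣ → Fin n
enumerate (true Vec.∷ p) Fin.zero = Fin.zero
enumerate (true Vec.∷ p) (Fin.suc i) = Fin.suc (enumerate p i)
enumerate (false Vec.∷ p) i = Fin.suc (enumerate p i)

enumerate-∈ : ∀ {n} (p : Subset n) i → enumerate p i ∈ₛ p
enumerate-∈ (true Vec.∷ p) Fin.zero = Vec.here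
enumerate-∈ (true Vec.∷ p) (Fin.suc i) = Vec.there (enumerate-∈ p i)
enumerate-∈ (false Vec.∷ p) i = Vec.there (enumerate-∈ p i)

enumerate-injective : ∀ {n} (p : Subset n) {i j} → enumerate p i ≡ enumerate p j → i ≡ j
enumerate-injective (true Vec.∷ p) {Fin.zero} {Fin.zero} _ = refl
enumerate-injective (true Vec.∷ p) {Fin.suc i} {Fin.suc j} eq = cong Fin.suc (enumerate-injective p (suc-injective eq))
enumerate-injective (false Vec.∷ p) eq = enumerate-injective p (suc-injective eq)

enumerate-surjective : ∀ {n} (p : Subset n) {x} → x ∈ₛ p → ∃ λ i → enumerate p i ≡ x
enumerate-surjective (true Vec.∷ p) Vec.here = Fin.zero , refl
enumerate-surjective (true Vec.∷ p) (Vec.there x∈p) with enumerate-surjective p x∈p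
... | i , refl = Fin.suc i , refl
enumerate-surjective (false Vec.∷ p) (Vec.there x∈p) with enumerate-surjective p x∈p
... | i , refl = i , refl

module _ (G : Graph) where
  open Graph G

  hasCard-punctured : {P : Subset nE → Set} {k : ℕ} (f : Fin k → Subset nE) (i₀ : Fin k) →
    (∀ {i} → i ≢ i₀ → P (f i)) →
    (∀ {i j} → i ≢ i₀ → j ≢ i₀ → f i ≡ f j → i ≡ j) →
    (∀ A → P A → ∃ λ i → i ≢ i₀ × f i ≡ A) →
    HasCard G P (k ∸ 1)
  hasCard-punctured {k = suc k} f i₀ P-f f-injective f-surjective =
    (λ j → f (punchIn i₀ j)) ,
    (λ i j eq → punchIn-injective i₀ i j (f-injective (≢i₀ i) (≢i₀ j) eq)) ,
    (λ j → P-f (≢i₀ j)) ,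
    λ A PA → let i , i≢i₀ , fi≡A = f-surjective A PA
             in punchOut (≢-sym i≢i₀) , trans (cong f (punchIn-punchOut (≢-sym i≢i₀))) fi≡A
    where
    ≢i₀ : ∀ j → punchIn i₀ j ≢ i₀
    ≢i₀ = punchInᵢ≢i i₀

Unique-reverse : {X : Set} {xs : List X} → Unique xs → Unique (reverse xs)
Unique-reverse {X} {xs} = Unique-resp-↭ (↭⇒↭ₛ (↭-sym (↭-reverse xs)))
  where open import Data.List.Relation.Binary.Permutation.Setoid.Properties (setoid X) using (Unique-resp-↭)

Unique-++⇒disjoint : {X : Set} (xs : List X) {ys : List X} {z : X} → Unique (xs ++ ys) → z ∈ xs → z ∉ ys
Unique-++⇒disjoint (x ∷ xs) (x∉ ∷ _) (here refl) z∈ys = All.lookup x∉ (∈-++⁺ʳ xs z∈ys) refl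
Unique-++⇒disjoint (x ∷ xs) (_ ∷ u) (there z∈xs) = Unique-++⇒disjoint xs u z∈xs

module Walks (G : Graph) where
  open Graph G
  open import Data.List.Membership.DecPropositional (_≟ᶠ_ {nV}) using () renaming (_∈?_ to _∈ᵛ?_)

  t-bar : ∀ e → t (bar e) ≡ o e
  t-bar e = trans (sym (o-bar (bar e))) (cong o (bar-invol e))

  sameEdge? : ∀ e f → Dec (SameEdge G e f)
  sameEdge? e f = (f ≟ᶠ e) ⊎-dec (f ≟ᶠ bar e)

  Chain[]⇒≡ : ∀ {x y} → Chain G x [] y → x ≡ y
  Chain[]⇒≡ nil = refl

  Chain-o : ∀ {x e es y} → Chain G x (e ∷ es) y → o e ≡ x
  Chain-o (cons oe≡x _) = oe≡x

  Chain-tail : ∀ {x e es y} → Chain G x (e ∷ es) y → Chain G (t e) es y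
  Chain-tail (cons _ c) = c

  Chain-++ : ∀ {x es y fs z} → Chain G x es y → Chain G y fs z → Chain G x (es ++ fs) z
  Chain-++ nil c = c
  Chain-++ (cons oe c) d = cons oe (Chain-++ c d)

  verts-++ : ∀ x es fs → verts G x (es ++ fs) ≡ verts G x es ++ map t fs
  verts-++ x es fs = cong (x ∷_) (map-++ t es fs)

  end∈targets : ∀ {x e es y} → Chain G x (e ∷ es) y → y ∈ map t (e ∷ es)
  end∈targets (cons _ nil) = here refl
  end∈targets (cons _ (cons oe c)) = there (end∈targets (cons oe c))

  end∈targets⊎≡start : ∀ {x es y} → Chain G x es y → y ∈ map t es ⊎ x ≡ y
  end∈targets⊎≡start nil = inj₂ refl
  end∈targets⊎≡start (cons oe c) = inj₁ (end∈targets (cons oe c))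

  end∈verts : ∀ {x es y} → Chain G x es y → y ∈ verts G x es
  end∈verts nil = here refl
  end∈verts (cons oe c) = there (end∈targets (cons oe c))

  o∈verts : ∀ {x es y e} → Chain G x es y → e ∈ es → o e ∈ verts G x es
  o∈verts (cons refl c) (here refl) = here refl
  o∈verts (cons oe c) (there e∈es) = there (o∈verts c e∈es)

  t∈verts : ∀ {x es e} → e ∈ es → t e ∈ verts G x es
  t∈verts e∈es = there (∈-map⁺ t e∈es)

  edgeOn⇒∈⊎bar∈ : ∀ {e es} → EdgeOn G e es → e ∈ es ⊎ bar e ∈ es
  edgeOn⇒∈⊎bar∈ (here (inj₁ refl)) = inj₁ (here refl)
  edgeOn⇒∈⊎bar∈ (here (inj₂ refl)) = inj₂ (here refl)
  edgeOn⇒∈⊎bar∈ (there on) with edgeOn⇒∈⊎bar∈ on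
  ... | inj₁ e∈ = inj₁ (there e∈)
  ... | inj₂ ē∈ = inj₂ (there ē∈)

  ∈⇒edgeOn : ∀ {e es} → e ∈ es → EdgeOn G e es
  ∈⇒edgeOn = Any.map inj₁ ∘ Any.map sym

  bar∈⇒edgeOn : ∀ {e es} → bar e ∈ es → EdgeOn G e es
  bar∈⇒edgeOn = Any.map inj₂ ∘ Any.map sym

  edgeOn-bar : ∀ {e es} → EdgeOn G e es → EdgeOn G (bar e) es
  edgeOn-bar on with edgeOn⇒∈⊎bar∈ on
  ... | inj₁ e∈ = bar∈⇒edgeOn (subst (_∈ _) (sym (bar-invol _)) e∈)
  ... | inj₂ ē∈ = ∈⇒edgeOn ē∈

  edgeOn⇒ends∈verts : ∀ {x es y e} → Chain G x es y → EdgeOn G e es → o e ∈ verts G x es × t e ∈ verts G x es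
  edgeOn⇒ends∈verts {x} {es} c on with edgeOn⇒∈⊎bar∈ on
  ... | inj₁ e∈ = o∈verts c e∈ , t∈verts e∈
  ... | inj₂ ē∈ = subst (_∈ verts G x es) (t-bar _) (t∈verts ē∈) , subst (_∈ verts G x es) (o-bar _) (o∈verts c ē∈)

  splitAt : ∀ {x es y u} → Chain G x es y → u ∈ verts G x es →
            ∃₂ λ es₁ es₂ → es ≡ es₁ ++ es₂ × Chain G x es₁ u × Chain G u es₂ y
  splitAt c (here refl) = [] , _ , refl , nil , c
  splitAt (cons oe c) (there u∈) with splitAt c u∈
  ... | es₁ , es₂ , refl , c₁ , c₂ = _ ∷ es₁ , es₂ , refl , cons oe c₁ , c₂

  reverseWalk : List (Fin nE) → List (Fin nE)
  reverseWalk [] = []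
  reverseWalk (e ∷ es) = reverseWalk es ++ [ bar e ]

  Chain-reverse : ∀ {x es y} → Chain G x es y → Chain G y (reverseWalk es) x
  Chain-reverse nil = nil
  Chain-reverse (cons {e = e} refl c) = Chain-++ (Chain-reverse c) (cons (o-bar e) (subst (Chain G _ []) (t-bar e) nil))

  verts-reverse : ∀ {x es y} → Chain G x es y → verts G y (reverseWalk es) ≡ reverse (verts G x es)
  verts-reverse nil = refl
  verts-reverse {x} {y = y} (cons {e = e} {es = es} refl c) = begin
    verts G y (reverseWalk es ++ [ bar e ])      ≡⟨ verts-++ y (reverseWalk es) [ bar e ] ⟩
    verts G y (reverseWalk es) ++ [ t (bar e) ]  ≡⟨ cong₂ (λ vs v → vs ++ [ v ]) (verts-reverse c) (t-bar e) ⟩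
    reverse (verts G (t e) es) ++ [ o e ]        ≡⟨ sym (unfold-reverse (o e) (verts G (t e) es)) ⟩
    reverse (verts G x (e ∷ es))                 ∎
    where open ≡-Reasoning

  ∈-reverse⁻ : ∀ {e} es → e ∈ reverseWalk es → bar e ∈ es
  ∈-reverse⁻ (f ∷ es) e∈ with ∈-++⁻ (reverseWalk es) e∈
  ... | inj₁ e∈′ = there (∈-reverse⁻ es e∈′)
  ... | inj₂ (here refl) = here (bar-invol f)

  ∈-reverse⁺ : ∀ {e} es → e ∈ es → bar e ∈ reverseWalk es
  ∈-reverse⁺ (f ∷ es) (here refl) = ∈-++⁺ʳ (reverseWalk es) (here refl)
  ∈-reverse⁺ (f ∷ es) (there e∈) = ∈-++⁺ˡ (∈-reverse⁺ es e∈)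

  edgeOn-reverse⁺ : ∀ {e} es → EdgeOn G e es → EdgeOn G e (reverseWalk es)
  edgeOn-reverse⁺ es on with edgeOn⇒∈⊎bar∈ on
  ... | inj₁ e∈ = bar∈⇒edgeOn (∈-reverse⁺ es e∈)
  ... | inj₂ ē∈ = ∈⇒edgeOn (subst (_∈ _) (bar-invol _) (∈-reverse⁺ es ē∈))

  Unique-verts-reverse : ∀ {x es y} → Chain G x es y → Unique (verts G x es) → Unique (verts G y (reverseWalk es))
  Unique-verts-reverse c u = subst Unique (sym (verts-reverse c)) (Unique-reverse u)

  ∈verts-reverse⁻ : ∀ {x es y z} → Chain G x es y → z ∈ verts G y (reverseWalk es) → z ∈ verts G x es
  ∈verts-reverse⁻ c z∈ = reverse⁻ (subst (_ ∈_) (verts-reverse c) z∈)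

  inner⊆verts : ∀ {x es y} → Chain G x es y → inner G es ⊆ verts G x es
  inner⊆verts (cons _ (cons _ _)) (here refl) = there (here refl)
  inner⊆verts (cons _ (cons oe c)) (there z∈) = there (inner⊆verts (cons oe c) z∈)

  ∈verts⇒ends⊎inner : ∀ {x es y z} → Chain G x es y → z ∈ verts G x es → z ≡ x ⊎ z ≡ y ⊎ z ∈ inner G es
  ∈verts⇒ends⊎inner nil (here refl) = inj₁ refl
  ∈verts⇒ends⊎inner (cons _ _) (here refl) = inj₁ refl
  ∈verts⇒ends⊎inner (cons _ nil) (there (here refl)) = inj₂ (inj₁ refl)
  ∈verts⇒ends⊎inner (cons _ (cons oe c)) (there z∈) with ∈verts⇒ends⊎inner (cons oe c) z∈
  ... | inj₁ refl = inj₂ (inj₂ (here refl))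
  ... | inj₂ (inj₁ z≡y) = inj₂ (inj₁ z≡y)
  ... | inj₂ (inj₂ z∈inner) = inj₂ (inj₂ (there z∈inner))

  inner⇒≢ends : ∀ {x es y z} → Chain G x es y → Unique (verts G x es) → z ∈ inner G es → z ≢ x × z ≢ y
  inner⇒≢ends (cons _ (cons oe c)) (x∉ ∷ u) (here refl) =
    (λ z≡x → All.lookup x∉ (here refl) (sym z≡x)) ,
    (λ z≡y → Unique[x∷xs]⇒x∉xs u (subst (_∈ _) (sym z≡y) (end∈targets (cons oe c))))
  inner⇒≢ends (cons _ (cons oe c)) (x∉ ∷ u) (there z∈) =
    (λ z≡x → All.lookup x∉ (inner⊆verts (cons oe c) z∈) (sym z≡x)) , proj₂ (inner⇒≢ends (cons oe c) u z∈)

  Unique-verts⇒DistinctEdges : ∀ {x es y} → Chain G x es y → Unique (verts G x es) → DistinctEdges G es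
  Unique-verts⇒DistinctEdges nil _ = []
  Unique-verts⇒DistinctEdges {x} (cons {e = e} oe c) (x∉ ∷ u) =
    All.tabulate notSame ∷ Unique-verts⇒DistinctEdges c u
    where
    notSame : ∀ {f} → f ∈ _ → ¬ SameEdge G e f
    notSame f∈ (inj₁ refl) = All.lookup x∉ (o∈verts c f∈) (sym oe)
    notSame f∈ (inj₂ refl) = All.lookup x∉ (t∈verts f∈) (sym (trans (t-bar e) oe))

  Unique-verts⇒o≢t : ∀ {x es y e} → Chain G x es y → Unique (verts G x es) → e ∈ es → o e ≢ t e
  Unique-verts⇒o≢t (cons oe c) (x∉ ∷ _) (here refl) oe≡te = All.lookup x∉ (here refl) (trans (sym oe) oe≡te)
  Unique-verts⇒o≢t (cons _ c) (_ ∷ u) (there e∈) = Unique-verts⇒o≢t c u e∈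

  verts-mono : ∀ {x es fs} → es ⊆ fs → verts G x es ⊆ verts G x fs
  verts-mono es⊆fs (here refl) = here refl
  verts-mono es⊆fs (there z∈) with ∈-map⁻ t z∈
  ... | e , e∈ , refl = t∈verts (es⊆fs e∈)

  record LoopErased (x : Fin nV) (es : List (Fin nE)) (y : Fin nV) : Set where
    field
      path   : List (Fin nE)
      chain  : Chain G x path y
      unique : Unique (verts G x path)
      edges⊆ : path ⊆ es

  restartAt : ∀ {x es y z} → z ∈ verts G x es → Chain G x es y → Unique (verts G x es) → LoopErased z es y
  restartAt (here refl) c u = record { chain = c ; unique = u ; edges⊆ = λ f∈ → f∈ }
  restartAt (there z∈) (cons _ c) (_ ∷ u) =
    let r = restartAt z∈ c u in record { LoopErased r ; edges⊆ = there ∘ LoopErased.edges⊆ r }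

  loopErase : ∀ {x es y} → Chain G x es y → LoopErased x es y
  loopErase nil = record { chain = nil ; unique = [] ∷ [] ; edges⊆ = λ () }
  loopErase {x} (cons {e = e} oe c) with loopErase c
  ... | record { path = rs ; chain = c′ ; unique = u′ ; edges⊆ = rs⊆ } with x ∈ᵛ? verts G (t e) rs
  ... | yes x∈ = let r = restartAt x∈ c′ u′ in record { LoopErased r ; edges⊆ = there ∘ rs⊆ ∘ LoopErased.edges⊆ r }
  ... | no x∉ = record
    { path = e ∷ rs ; chain = cons oe c′ ; unique = ¬Any⇒All¬ _ x∉ ∷ u′
    ; edges⊆ = λ { (here refl) → here refl ; (there f∈) → there (rs⊆ f∈) } }

  star⇒chain : ∀ {E x y} → Star (Adj G E) x y → ∃ λ es → Chain G x es y × All (_∈ₛ E) es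
  star⇒chain ε = [] , nil , []
  star⇒chain ((e , e∈E , oe , refl) ◅ s) with star⇒chain s
  ... | es , c , es⊆E = e ∷ es , cons oe c , e∈E ∷ es⊆E

  star⇒uniqueChain : ∀ {E x y} → Star (Adj G E) x y → ∃ λ es → Chain G x es y × Unique (verts G x es) × All (_∈ₛ E) es
  star⇒uniqueChain s with star⇒chain s
  ... | es , c , es⊆E = let open LoopErased (loopErase c) in
    path , chain , unique , All.tabulate (All.lookup es⊆E ∘ edges⊆)

  share-intro : ∀ {e es fs} → EdgeOn G e es → EdgeOn G e fs → Share G es fs
  share-intro on on′ with edgeOn⇒∈⊎bar∈ on
  ... | inj₁ e∈ = lose e∈ on′
  ... | inj₂ ē∈ = lose ē∈ (edgeOn-bar on′)

  share-mono : ∀ {es fs es′ fs′} → (∀ {e} → EdgeOn G e es → EdgeOn G e es′) →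
               (∀ {e} → EdgeOn G e fs → EdgeOn G e fs′) → Share G es fs → Share G es′ fs′
  share-mono es⊑ fs⊑ sh with find sh
  ... | e , e∈ , on = share-intro (es⊑ (∈⇒edgeOn e∈)) (fs⊑ on)

  share-sym : ∀ {es fs} → Share G es fs → Share G fs es
  share-sym sh with find sh
  ... | e , e∈ , on = share-intro on (∈⇒edgeOn e∈)

  -- If not, the first walk followed by the reverse of the second contains a cycle through e.
  acyclic⇒sameFirstEdge : ∀ {T x e es f fs y} → (∀ {g} → g ∈ₛ T → bar g ∈ₛ T) → ¬ HasCycle G T →
    Chain G x (e ∷ es) y → Chain G x (f ∷ fs) y → All (_∈ₛ T) (e ∷ es) → All (_∈ₛ T) (f ∷ fs) →
    x ∉ map t (e ∷ es) → x ∉ map t (f ∷ fs) → SameEdge G e f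
  acyclic⇒sameFirstEdge {T} {x} {e} {es} {f} {fs} bar∈T acyclic (cons oe c₁) c₂ e∷es⊆T f∷fs⊆T x∉₁ x∉₂
    with sameEdge? e f
  ... | yes same = same
  ... | no ¬same with loopErase (Chain-++ c₁ (Chain-reverse c₂))
  ... | record { path = rs ; chain = c ; unique = u ; edges⊆ = rs⊆ } =
    ⊥-elim (acyclic (x , e ∷ rs , cons oe c , s≤s z≤n , All.head e∷es⊆T ∷ All.tabulate (∈T ∘ rs⊆) ,
                     All.tabulate (notSame ∘ rs⊆) ∷ Unique-verts⇒DistinctEdges c u , u))
    where
    ∈T : ∀ {g} → g ∈ es ++ reverseWalk (f ∷ fs) → g ∈ₛ T
    ∈T {g} g∈ with ∈-++⁻ es g∈
    ... | inj₁ g∈es = All.lookup (All.tail e∷es⊆T) g∈es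
    ... | inj₂ g∈rev = subst (_∈ₛ T) (bar-invol g) (bar∈T (All.lookup f∷fs⊆T (∈-reverse⁻ (f ∷ fs) g∈rev)))
    oe∈₂ : e ∈ f ∷ fs → ⊥
    oe∈₂ (here e≡f) = ¬same (inj₁ (sym e≡f))
    oe∈₂ (there e∈fs) = x∉₂ (subst (_∈ _) oe (o∈verts (Chain-tail c₂) e∈fs))
    ē∈₂ : bar e ∈ f ∷ fs → ⊥
    ē∈₂ (here ē≡f) = ¬same (inj₂ (sym ē≡f))
    ē∈₂ (there ē∈fs) = x∉₂ (subst (_∈ _) (trans (t-bar e) oe) (t∈verts ē∈fs))
    notSame : ∀ {g} → g ∈ es ++ reverseWalk (f ∷ fs) → ¬ SameEdge G e g
    notSame g∈ same with ∈-++⁻ es g∈ | same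
    ... | inj₁ g∈es | inj₁ refl = x∉₁ (subst (_∈ _) oe (o∈verts c₁ g∈es))
    ... | inj₁ g∈es | inj₂ refl = x∉₁ (subst (_∈ _) (trans (t-bar e) oe) (t∈verts g∈es))
    ... | inj₂ g∈rev | inj₁ refl = ē∈₂ (∈-reverse⁻ (f ∷ fs) g∈rev)
    ... | inj₂ g∈rev | inj₂ refl = oe∈₂ (subst (_∈ _) (bar-invol e) (∈-reverse⁻ (f ∷ fs) g∈rev))

module Admissibility (G : Graph) where
  open Graph G
  open Walks G

  ram? : ∀ z → Dec (Ram G z)
  ram? z = z ∈ₛ? ramified

  RamifiedOnlyAtEnds : Fin nV → List (Fin nE) → Fin nV → Set
  RamifiedOnlyAtEnds v es w = ∀ {z} → z ∈ verts G v es → Ram G z → z ≡ v ⊎ z ≡ w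

  -- Unlike `Admissible`, this form is stable under reversal and splicing.
  record Admissible′ (v : Fin nV) (es : List (Fin nE)) (w : Fin nV) : Set where
    field
      chain      : Chain G v es w
      unique     : Unique (verts G v es)
      ram-start  : Ram G v
      ram-end    : Ram G w
      start≢end  : v ≢ w
      onlyAtEnds : RamifiedOnlyAtEnds v es w

  toAdmissible′ : ∀ {v es w} → Admissible G v es w → Admissible′ v es w
  toAdmissible′ ((c , u , _) , ram-v , ram-w , v≢w , innerUnram) = record
    { chain = c ; unique = u ; ram-start = ram-v ; ram-end = ram-w ; start≢end = v≢w ; onlyAtEnds = onlyAtEnds }
    where
    onlyAtEnds : RamifiedOnlyAtEnds _ _ _
    onlyAtEnds z∈ ram-z with ∈verts⇒ends⊎inner c z∈
    ... | inj₁ z≡v = inj₁ z≡v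
    ... | inj₂ (inj₁ z≡w) = inj₂ z≡w
    ... | inj₂ (inj₂ z∈inner) = ⊥-elim (All.lookup innerUnram z∈inner ram-z)

  fromAdmissible′ : ∀ {v es w} → Admissible′ v es w → Admissible G v es w
  fromAdmissible′ a =
    (chain , unique , Unique-verts⇒DistinctEdges chain unique) , ram-start , ram-end , start≢end ,
    All.tabulate innerUnram
    where
    open Admissible′ a
    innerUnram : ∀ {z} → z ∈ inner G _ → Unram G z
    innerUnram z∈ ram-z with inner⇒≢ends chain unique z∈ | onlyAtEnds (inner⊆verts chain z∈) ram-z
    ... | z≢v , _ | inj₁ z≡v = z≢v z≡v
    ... | _ , z≢w | inj₂ z≡w = z≢w z≡w

  Admissible′-reverse : ∀ {v es w} → Admissible′ v es w → Admissible′ w (reverseWalk es) v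
  Admissible′-reverse a = record
    { chain = Chain-reverse chain ; unique = Unique-verts-reverse chain unique
    ; ram-start = ram-end ; ram-end = ram-start ; start≢end = λ w≡v → start≢end (sym w≡v)
    ; onlyAtEnds = λ z∈ ram-z → [ inj₂ , inj₁ ]′ (onlyAtEnds (∈verts-reverse⁻ chain z∈) ram-z) }
    where open Admissible′ a

  AdmPath-reverse : ∀ {v w} → AdmPath G v w → AdmPath G w v
  AdmPath-reverse (es , a) = reverseWalk es , fromAdmissible′ (Admissible′-reverse (toAdmissible′ a))

  chain? : ∀ x es y → Dec (Chain G x es y)
  chain? x [] y with x ≟ᶠ y
  ... | yes refl = yes nil
  ... | no x≢y = no λ { nil → x≢y refl }
  chain? x (e ∷ es) y with o e ≟ᶠ x | chain? (t e) es y
  ... | yes oe | yes c = yes (cons oe c)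
  ... | no oe≢x | _ = no λ { (cons oe _) → oe≢x oe }
  ... | _ | no ¬c = no λ { (cons _ c) → ¬c c }

  edgeOn? : ∀ e es → Dec (EdgeOn G e es)
  edgeOn? e = any? (sameEdge? e)

  share? : ∀ es fs → Dec (Share G es fs)
  share? es fs = any? (λ e → edgeOn? e fs) es

  admissible? : ∀ v es w → Dec (Admissible G v es w)
  admissible? v es w =
    ((chain? v es w ×-dec allPairs? (λ x y → ¬? (x ≟ᶠ y)) (verts G v es) ×-dec
      allPairs? (λ e f → ¬? (sameEdge? e f)) es) ×-dec
    ram? v ×-dec ram? w ×-dec ¬? (v ≟ᶠ w) ×-dec all? (¬? ∘ ram?) (inner G es))

  admissible⇒length≤ : ∀ {v es w} → Admissible G v es w → length es ≤ nV
  admissible⇒length≤ {v} {es} ((_ , u , _) , _) = begin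
    length es              ≤⟨ n≤1+n (length es) ⟩
    suc (length es)        ≡⟨ cong suc (length-map t es) ⟨
    length (verts G v es)  ≤⟨ unique⊆⇒length≤ _≟ᶠ_ u (λ {z} _ → ∈-allFin z) ⟩
    length (allFin nV)     ≡⟨ length-tabulate (λ i → i) ⟩
    nV                     ∎
    where open ≤-Reasoning

  -- Admissible paths have distinct vertices, so searching the paths with at most nV edges decides
  -- the class of an admissible path and membership in a 2-segment.
  candidatePaths : List (List (Fin nE))
  candidatePaths = listsUpTo nV

  admissible∈candidates : ∀ {v es w} → Admissible G v es w → es ∈ candidatePaths
  admissible∈candidates a = ∈-listsUpTo nV _ (admissible⇒length≤ a)

  module _ (v w : Fin nV) where

    SharingAdmissible : List (Fin nE) → List (Fin nE) → Set
    SharingAdmissible es fs = Admissible G v fs w × Share G es fs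

    open FiniteReachability (≡-dec _≟ᶠ_) (λ es fs → admissible? v fs w ×-dec share? es fs)
      candidatePaths (admissible∈candidates ∘ proj₁) using (star?)

    sameClass⇒star : ∀ {p q} → SameClass G p q → Star SharingAdmissible (proj₁ p) (proj₁ q)
    sameClass⇒star ε = ε
    sameClass⇒star (_◅_ {j = q} p~q q~r) = (proj₂ q , p~q) ◅ sameClass⇒star q~r

    star⇒sameClass : ∀ (p : AdmPath G v w) {es} → Star SharingAdmissible (proj₁ p) es →
                     (a : Admissible G v es w) → SameClass G p (es , a)
    star⇒sameClass p ε a = share-self a ◅ ε
      where
      share-self : ∀ {es} → Admissible G v es w → Share G es es
      share-self {[]} ((nil , _) , _ , _ , v≢v , _) = ⊥-elim (v≢v refl)
      share-self {e ∷ es} _ = here (here (inj₁ refl))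
    star⇒sameClass p ((a′ , p~q) ◅ s) a = p~q ◅ star⇒sameClass (_ , a′) s a

    ClassEdge : AdmPath G v w → Fin nE → Set
    ClassEdge p e = ∃ λ q → SameClass G p q × EdgeOn G e (proj₁ q)

    classEdge? : ∀ p e → Dec (ClassEdge p e)
    classEdge? p e = map′ fromAny toAny
      (any? (λ es → admissible? v es w ×-dec star? (proj₁ p) es ×-dec edgeOn? e es) candidatePaths)
      where
      Witness : List (Fin nE) → Set
      Witness es = Admissible G v es w × Star SharingAdmissible (proj₁ p) es × EdgeOn G e es
      fromAny : Any Witness candidatePaths → ClassEdge p e
      fromAny any with Any.satisfied any
      ... | es , a , s , on = (es , a) , star⇒sameClass p s a , on
      toAny : ClassEdge p e → Any Witness candidatePaths
      toAny ((es , a) , p~q , on) = lose (admissible∈candidates a) (a , sameClass⇒star p~q , on)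

    segmentOf : AdmPath G v w → Subset nE
    segmentOf p = decToSubset (classEdge? p)

    segmentOf-Is2Seg : ∀ p → Is2Seg G (segmentOf p)
    segmentOf-Is2Seg p = v , w , p , λ e → ∈-decToSubset⁻ (classEdge? p) , ∈-decToSubset⁺ (classEdge? p)

    edgeOn⇒∈segmentOf : ∀ p {e} → EdgeOn G e (proj₁ p) → e ∈ₛ segmentOf p
    edgeOn⇒∈segmentOf p on = ∈-decToSubset⁺ (classEdge? p) (p , ε , on)

  -- Opaque, because `with` over the unfolded search is very slow to check.
  opaque
    edgeIn2Seg? : ∀ e → Dec (EdgeIn2Seg G e)
    edgeIn2Seg? e = map′ fromAny toAny
      (any? (λ v → any? (λ w → any? (λ es → admissible? v es w ×-dec edgeOn? e es)
                                      candidatePaths) (allFin nV)) (allFin nV))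
      where
      Witness : Set
      Witness = Any (λ v → Any (λ w → Any (λ es → Admissible G v es w × EdgeOn G e es)
                                          candidatePaths) (allFin nV)) (allFin nV)
      fromAny : Witness → EdgeIn2Seg G e
      fromAny any with Any.satisfied any
      ... | v , any′ with Any.satisfied any′
      ... | w , any″ with Any.satisfied any″
      ... | es , a , on = segmentOf v w (es , a) , segmentOf-Is2Seg v w (es , a) , edgeOn⇒∈segmentOf v w (es , a) on
      toAny : EdgeIn2Seg G e → Witness
      toAny (A , (v , w , p , spec) , e∈A) with proj₁ (spec e) e∈A
      ... | q , _ , on = lose (∈-allFin v) (lose (∈-allFin w) (lose (admissible∈candidates (proj₂ q)) (proj₂ q , on)))

  OnlyRamified : Fin nV → List (Fin nV) → Set
  OnlyRamified r vs = ∀ {z} → z ∈ vs → Ram G z → z ≡ r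

  splitAtUnramified : ∀ {a es b u es₁ es₂} → Admissible′ a es b → es ≡ es₁ ++ es₂ →
    Chain G a es₁ u → Chain G u es₂ b → Unram G u →
    OnlyRamified a (verts G a es₁) × OnlyRamified b (verts G u es₂)
  splitAtUnramified {a} {_} {b} {u} {es₁} {es₂} q refl c₁ c₂ unram-u = prefix , suffix
    where
    open Admissible′ q
    split-unique : Unique (verts G a es₁ ++ map t es₂)
    split-unique = subst Unique (verts-++ a es₁ es₂) unique
    toWhole : ∀ {z} → z ∈ verts G a es₁ ++ map t es₂ → z ∈ verts G a (es₁ ++ es₂)
    toWhole {z} = subst (z ∈_) (sym (verts-++ a es₁ es₂))
    prefix : OnlyRamified a (verts G a es₁)
    prefix z∈ ram-z with onlyAtEnds (toWhole (∈-++⁺ˡ z∈)) ram-z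
    ... | inj₁ z≡a = z≡a
    ... | inj₂ refl with end∈targets⊎≡start c₂
    ...   | inj₁ b∈ = ⊥-elim (Unique-++⇒disjoint (verts G a es₁) split-unique z∈ b∈)
    ...   | inj₂ refl = ⊥-elim (unram-u ram-z)
    suffix : OnlyRamified b (verts G u es₂)
    suffix (here refl) ram-u = ⊥-elim (unram-u ram-u)
    suffix (there z∈) ram-z with onlyAtEnds (toWhole (∈-++⁺ʳ (verts G a es₁) z∈)) ram-z
    ... | inj₂ z≡b = z≡b
    ... | inj₁ refl = ⊥-elim (Unique-++⇒disjoint (verts G a es₁) split-unique (here refl) z∈)

  AdmissibleThrough : Fin nV → List (Fin nE) → List (Fin nE) → Fin nV → Set
  AdmissibleThrough s as bs s′ =
    Σ (List (Fin nE)) λ rs → Admissible G s rs s′ × (∃ λ e → e ∈ rs × e ∈ as) × (∃ λ e → e ∈ rs × e ∈ bs)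

  splice : ∀ {s u s′ as bs} → Ram G s → Ram G s′ → s ≢ s′ → Chain G s as u → Chain G u bs s′ →
    OnlyRamified s (verts G s as) → OnlyRamified s′ (verts G u bs) → AdmissibleThrough s as bs s′
  splice {s} {u} {s′} {as} {bs} ram-s ram-s′ s≢s′ c₁ c₂ only-s only-s′ with loopErase (Chain-++ c₁ c₂)
  ... | record { path = [] ; chain = c } = ⊥-elim (s≢s′ (Chain[]⇒≡ c))
  ... | record { path = e ∷ es ; chain = c ; unique = u ; edges⊆ = ⊆as++bs } =
    e ∷ es , fromAdmissible′ admissible′ , firstEdge , lastEdge
    where
    admissible′ : Admissible′ s (e ∷ es) s′
    admissible′ = record
      { chain = c ; unique = u ; ram-start = ram-s ; ram-end = ram-s′ ; start≢end = s≢s′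
      ; onlyAtEnds = λ {z} z∈ ram-z →
          [ (λ z∈as → inj₁ (only-s z∈as ram-z)) , (λ z∈bs → inj₂ (only-s′ (there z∈bs) ram-z)) ]′
          (∈-++⁻ (verts G s as) (subst (z ∈_) (verts-++ s as bs) (verts-mono ⊆as++bs z∈))) }
    firstEdge : ∃ λ f → f ∈ e ∷ es × f ∈ as
    firstEdge with ∈-++⁻ as (⊆as++bs (here refl))
    ... | inj₁ e∈as = e , here refl , e∈as
    ... | inj₂ e∈bs =
      ⊥-elim (s≢s′ (trans (sym (Chain-o c)) (only-s′ (o∈verts c₂ e∈bs) (subst (Ram G) (sym (Chain-o c)) ram-s))))
    lastEdge : ∃ λ f → f ∈ e ∷ es × f ∈ bs
    lastEdge with ∈-map⁻ t (end∈targets c)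
    ... | f , f∈ , s′≡tf with ∈-++⁻ as (⊆as++bs f∈)
    ...   | inj₂ f∈bs = f , f∈ , f∈bs
    ...   | inj₁ f∈as = ⊥-elim (s≢s′ (sym (trans s′≡tf (only-s (t∈verts f∈as) (subst (Ram G) s′≡tf ram-s′)))))

  SharingPathFrom : Fin nV → List (Fin nE) → List (Fin nE) → Set
  SharingPathFrom a es es′ = ∃ λ s′ → Σ (AdmPath G a s′) λ r → Share G (proj₁ r) es × Share G (proj₁ r) es′

  through⇒sharing : ∀ {a as bs s′ es es′} → as ⊆ es → (∀ {e} → e ∈ bs → EdgeOn G e es′) →
    AdmissibleThrough a as bs s′ → SharingPathFrom a es es′
  through⇒sharing as⊆es bs⊑es′ (rs , r , (e , e∈rs , e∈as) , (f , f∈rs , f∈bs)) =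
    _ , (rs , r) , share-intro (∈⇒edgeOn e∈rs) (∈⇒edgeOn (as⊆es e∈as)) , share-intro (∈⇒edgeOn f∈rs) (bs⊑es′ f∈bs)

  -- Splice the part of q before u with the part of q′ after u or, if that part would end at a,
  -- with the reversed part of q′ before u.
  bridge : ∀ {a es b a′ es′ b′ u} → Admissible′ a es b → Admissible′ a′ es′ b′ →
    u ∈ verts G a es → u ∈ verts G a′ es′ → Unram G u → SharingPathFrom a es es′
  bridge {a} {es} {b} {a′} {es′} {b′} q q′ u∈ u∈′ unram-u
    with splitAt (Admissible′.chain q) u∈ | splitAt (Admissible′.chain q′) u∈′
  ... | es₁ , es₂ , refl , c₁ , c₂ | es₁′ , es₂′ , refl , c₁′ , c₂′
    with splitAtUnramified q refl c₁ c₂ unram-u | splitAtUnramified q′ refl c₁′ c₂′ unram-u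
  ... | only-a , _ | only-a′ , only-b′ with b′ ≟ᶠ a
  ... | no b′≢a =
    through⇒sharing ∈-++⁺ˡ (∈⇒edgeOn ∘ ∈-++⁺ʳ es₁′)
      (splice (Admissible′.ram-start q) (Admissible′.ram-end q′) (λ a≡b′ → b′≢a (sym a≡b′))
         c₁ c₂′ only-a only-b′)
  ... | yes refl =
    through⇒sharing ∈-++⁺ˡ (λ e∈ → bar∈⇒edgeOn (∈-++⁺ˡ (∈-reverse⁻ es₁′ e∈)))
      (splice (Admissible′.ram-start q) (Admissible′.ram-start q′) (λ a≡a′ → Admissible′.start≢end q′ (sym a≡a′))
         c₁ (Chain-reverse c₁′) only-a (λ z∈ → only-a′ (∈verts-reverse⁻ c₁′ z∈)))

module SegmentDecomposition (G : Graph) (SD : HasSegmentDecomposition G) where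
  open Graph G
  open Walks G
  open Admissibility G

  samePair : ∀ {v w v′ w′} (p : AdmPath G v w) (q : AdmPath G v′ w′) →
             Share G (proj₁ p) (proj₁ q) → SamePair G v w v′ w′
  samePair {v} {w} {v′} {w′} p q sh
    with ((v ≟ᶠ v′) ×-dec (w ≟ᶠ w′)) ⊎-dec ((v ≟ᶠ w′) ×-dec (w ≟ᶠ v′))
  ... | yes same = same
  ... | no ¬same = ⊥-elim (proj₁ SD v w v′ w′ p q ¬same sh)

  orient : ∀ {v w v′ w′} → SamePair G v w v′ w′ → AdmPath G v′ w′ → AdmPath G v w
  orient (inj₁ (refl , refl)) q = q
  orient (inj₂ (refl , refl)) q = AdmPath-reverse q

  edgeOn-orient : ∀ {v w v′ w′} (sp : SamePair G v w v′ w′) (q : AdmPath G v′ w′) {e} →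
                  EdgeOn G e (proj₁ q) → EdgeOn G e (proj₁ (orient sp q))
  edgeOn-orient (inj₁ (refl , refl)) q on = on
  edgeOn-orient (inj₂ (refl , refl)) q on = edgeOn-reverse⁺ _ on

  sameClass-orient : ∀ {v w v′ w′} (sp : SamePair G v w v′ w′) {p q : AdmPath G v′ w′} →
                     SameClass G p q → SameClass G (orient sp p) (orient sp q)
  sameClass-orient sp ε = ε
  sameClass-orient sp {p} (_◅_ {j = q} p~q q~r) =
    share-mono (edgeOn-orient sp p) (edgeOn-orient sp q) p~q ◅ sameClass-orient sp q~r

  sameClass-sym : ∀ {v w} {p q : AdmPath G v w} → SameClass G p q → SameClass G q p
  sameClass-sym = Star.reverse share-sym

  OnClosedPath : Fin nE → Set
  OnClosedPath f = ∃ λ z → Ram G z × ∃ λ es → ClosedPath G z es × EdgeOn G f es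

  edgeIn2Seg⊎onClosedPath : ∀ f → EdgeIn2Seg G f ⊎ OnClosedPath f
  edgeIn2Seg⊎onClosedPath f with edgeIn2Seg? f
  ... | yes in2Seg = inj₁ in2Seg
  ... | no ¬in2Seg = inj₂ (proj₂ SD f ¬in2Seg)

  closedPath-vertex : ∀ {z es x} → ClosedPath G z es → x ∈ verts G z es → x ≡ z ⊎ (Unram G x × ¬ VertIn2Seg G x)
  closedPath-vertex (c , _ , _ , _ , innerFree) x∈ with ∈verts⇒ends⊎inner c x∈
  ... | inj₁ x≡z = inj₁ x≡z
  ... | inj₂ (inj₁ x≡z) = inj₁ x≡z
  ... | inj₂ (inj₂ x∈inner) = inj₂ (All.lookup innerFree x∈inner)

  closedPath-o : ∀ {f} → (onC : OnClosedPath f) → o f ≡ proj₁ onC ⊎ (Unram G (o f) × ¬ VertIn2Seg G (o f))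
  closedPath-o (_ , _ , _ , cp , on) = closedPath-vertex cp (proj₁ (edgeOn⇒ends∈verts (proj₁ cp) on))

  module TwoSegment {A : Subset nE} (isA : Is2Seg G A) where

    a b : Fin nV
    a = proj₁ isA
    b = proj₁ (proj₂ isA)

    generator : AdmPath G a b
    generator = proj₁ (proj₂ (proj₂ isA))

    ∈⇒classEdge : ∀ {e} → e ∈ₛ A → ClassEdge a b generator e
    ∈⇒classEdge = proj₁ (proj₂ (proj₂ (proj₂ isA)) _)

    classEdge⇒∈ : ∀ {e} → ClassEdge a b generator e → e ∈ₛ A
    classEdge⇒∈ = proj₂ (proj₂ (proj₂ (proj₂ isA)) _)

    IsEnd : Fin nV → Set
    IsEnd z = z ≡ a ⊎ z ≡ b

    open Admissible′ (toAdmissible′ (proj₂ generator)) using () renaming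
      (start≢end to a≢b; ram-start to ram-a; ram-end to ram-b; chain to generator-chain) public

    bar∈ : ∀ {e} → e ∈ₛ A → bar e ∈ₛ A
    bar∈ e∈A with ∈⇒classEdge e∈A
    ... | q , p~q , on = classEdge⇒∈ (q , p~q , edgeOn-bar on)

    t∈VertOf : ∀ {e} → e ∈ₛ A → VertOf G A (t e)
    t∈VertOf {e} e∈A = bar e , bar∈ e∈A , o-bar e

    ends∈VertOf : VertOf G A a × VertOf G A b
    ends∈VertOf = ends∈ generator-chain (λ e∈ → classEdge⇒∈ (generator , ε , ∈⇒edgeOn e∈))
      where
      ends∈ : ∀ {es} → Chain G a es b → (∀ {e} → e ∈ es → e ∈ₛ A) → VertOf G A a × VertOf G A b
      ends∈ {[]} c _ = ⊥-elim (a≢b (Chain[]⇒≡ c))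
      ends∈ {e ∷ _} c es⊆A with ∈-map⁻ t (end∈targets c)
      ... | f , f∈ , b≡tf = (e , es⊆A (here refl) , Chain-o c) , subst (VertOf G A) (sym b≡tf) (t∈VertOf (es⊆A f∈))

    a∈VertOf : VertOf G A a
    a∈VertOf = proj₁ ends∈VertOf

    b∈VertOf : VertOf G A b
    b∈VertOf = proj₂ ends∈VertOf

    ramified⇒end : ∀ {z} → VertOf G A z → Ram G z → IsEnd z
    ramified⇒end (e , e∈A , refl) ram-z with ∈⇒classEdge e∈A
    ... | (_ , q) , _ , on = onlyAtEnds (proj₁ (edgeOn⇒ends∈verts chain on)) ram-z
      where open Admissible′ (toAdmissible′ q)


  module _ {A : Subset nE} (isA : Is2Seg G A) where
    open TwoSegment isA

    bridged⇒∈ : (q : AdmPath G a b) → SameClass G generator q → ∀ {v′ w′} (q′ : AdmPath G v′ w′) →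
                SharingPathFrom a (proj₁ q) (proj₁ q′) → ∀ {f} → EdgeOn G f (proj₁ q′) → f ∈ₛ A
    bridged⇒∈ q p~q q′ (s′ , r , r~q , r~q′) f-on with samePair q r (share-sym r~q)
    ... | inj₂ (_ , b≡a) = ⊥-elim (a≢b (sym b≡a))
    ... | inj₁ (_ , refl) = classEdge⇒∈ (orient sp q′ , p~q′ , edgeOn-orient sp q′ f-on)
      where
      sp : SamePair G a b _ _
      sp = samePair r q′ r~q′
      p~q′ : SameClass G generator (orient sp q′)
      p~q′ = p~q ◅◅ (_◅_ {j = r} (share-sym r~q) (share-mono (λ on → on) (edgeOn-orient sp q′) r~q′ ◅ ε))

    -- f cannot lie on a closed path, whose interior avoids 2-segments; so f lies in some 2-segment A′,
    -- and bridging admissible paths of A and A′ through u merges their classes.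
    edge-at-unramified∈ : ∀ {u f} → VertOf G A u → Unram G u → o f ≡ u → f ∈ₛ A
    edge-at-unramified∈ {u} {f} u∈A@(g , g∈A , og≡u) unram-u of≡u with edgeIn2Seg⊎onClosedPath f
    ... | inj₂ onC@(_ , ram-z , _) with closedPath-o onC
    ...   | inj₁ of≡z = ⊥-elim (unram-u (subst (Ram G) (trans (sym of≡z) of≡u) ram-z))
    ...   | inj₂ (_ , free) = ⊥-elim (free (subst (VertIn2Seg G) (sym of≡u) (A , isA , u∈A)))
    edge-at-unramified∈ {u} {f} u∈A@(g , g∈A , og≡u) unram-u of≡u | inj₁ (A′ , isA′ , f∈A′)
      with ∈⇒classEdge g∈A | TwoSegment.∈⇒classEdge isA′ f∈A′
    ... | q , p~q , g-on | q′ , _ , f-on =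
      bridged⇒∈ q p~q q′
        (bridge (toAdmissible′ (proj₂ q)) (toAdmissible′ (proj₂ q′))
           (onVerts q g-on og≡u) (onVerts q′ f-on of≡u) unram-u)
        f-on
      where
      onVerts : ∀ {v w e} (r : AdmPath G v w) → EdgeOn G e (proj₁ r) → o e ≡ u → u ∈ verts G v (proj₁ r)
      onVerts r on refl = proj₁ (edgeOn⇒ends∈verts (Admissible′.chain (toAdmissible′ (proj₂ r))) on)

  Is2Seg-⊆ : ∀ {A A′ e} (isA : Is2Seg G A) (isA′ : Is2Seg G A′) → e ∈ₛ A → e ∈ₛ A′ → ∀ {f} → f ∈ₛ A′ → f ∈ₛ A
  Is2Seg-⊆ isA isA′ e∈A e∈A′ f∈A′
    with TwoSegment.∈⇒classEdge isA e∈A | TwoSegment.∈⇒classEdge isA′ e∈A′ | TwoSegment.∈⇒classEdge isA′ f∈A′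
  ... | q , p~q , e-on-q | q′ , p′~q′ , e-on-q′ | r , p′~r , f-on-r =
    TwoSegment.classEdge⇒∈ isA (orient sp r , p~r , edgeOn-orient sp r f-on-r)
    where
    sp : SamePair G _ _ _ _
    sp = samePair q q′ (share-intro e-on-q e-on-q′)
    p~r : SameClass G (TwoSegment.generator isA) (orient sp r)
    p~r = p~q ◅◅ (_◅_ {j = orient sp q′} (share-intro e-on-q (edgeOn-orient sp q′ e-on-q′))
                    (sameClass-orient sp (sameClass-sym p′~q′) ◅◅ sameClass-orient sp p′~r))

  Is2Seg-≡ : ∀ {A A′ e} → Is2Seg G A → Is2Seg G A′ → e ∈ₛ A → e ∈ₛ A′ → A ≡ A′
  Is2Seg-≡ isA isA′ e∈A e∈A′ = ⊆-antisym (Is2Seg-⊆ isA′ isA e∈A′ e∈A) (Is2Seg-⊆ isA isA′ e∈A e∈A′)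

  module _ {A : Subset nE} (isA : Is2Seg G A) where
    open TwoSegment isA

    ReachesEnd : Subset nE → Fin nV → List (Fin nE) → Set
    ReachesEnd E x es = ∃ λ z → IsEnd z × z ∈ map t es × Star (Adj G (A ∩ E)) x z

    -- By edge-at-unramified∈ the walk stays in A up to its first ramified vertex, an end of A.
    reachEnd : ∀ {E x e es y} → Chain G x (e ∷ es) y → e ∈ₛ A → Ram G y → All (_∈ₛ E) (e ∷ es) →
               ReachesEnd E x (e ∷ es)
    reachEnd {E} {x} {e} (cons oe c) e∈A ram-y (e∈E ∷ es⊆E) with ram? (t e)
    ... | yes ram-te = t e , ramified⇒end (t∈VertOf e∈A) ram-te , here refl , step ◅ ε
      where
      step : Adj G (A ∩ E) x (t e)
      step = e , x∈p∩q⁺ (e∈A , e∈E) , oe , refl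
    ... | no unram-te with c | es⊆E
    ...   | nil | [] = ⊥-elim (unram-te ram-y)
    ...   | cons oe′ c′ | es⊆E′
      with reachEnd (cons oe′ c′) (edge-at-unramified∈ isA (t∈VertOf e∈A) unram-te oe′) ram-y es⊆E′
    ...     | z , z-end , z∈ , s = z , z-end , there z∈ , (e , x∈p∩q⁺ (e∈A , e∈E) , oe , refl) ◅ s

  closedPath-edge∈2seg⇒loop : ∀ {z c g} → ClosedPath G z c → g ∈ c → EdgeIn2Seg G g → o g ≡ t g
  closedPath-edge∈2seg⇒loop {g = g} cp g∈c (A , isA , g∈A)
    with closedPath-vertex cp (o∈verts (proj₁ cp) g∈c) | closedPath-vertex cp (t∈verts g∈c)
  ... | inj₂ (_ , free) | _ = ⊥-elim (free (A , isA , g , g∈A , refl))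
  ... | _ | inj₂ (_ , free) = ⊥-elim (free (A , isA , TwoSegment.t∈VertOf isA g∈A))
  ... | inj₁ og≡z | inj₁ tg≡z = trans og≡z (sym tg≡z)

  closedPath-prefix-onlyRamified : ∀ {z c c₁ c₂} → ClosedPath G z c → c ≡ c₁ ++ c₂ → OnlyRamified z (verts G z c₁)
  closedPath-prefix-onlyRamified cp refl w∈ ram-w with closedPath-vertex cp (verts-mono ∈-++⁺ˡ w∈)
  ... | inj₁ w≡z = w≡z
  ... | inj₂ (unram-w , _) = ⊥-elim (unram-w ram-w)

  -- If z ≢ z′, splicing the two closed paths at x gives an admissible path, whose
  -- 2-segment would contain an edge of a closed path.
  closedPaths-meet⇒sameBase : ∀ {z z′ c c′ x} → ClosedPath G z c → ClosedPath G z′ c′ → Ram G z → Ram G z′ →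
    x ∈ verts G z c → x ∈ verts G z′ c′ → Unram G x → z ≡ z′
  closedPaths-meet⇒sameBase {z} {z′} cp cp′ ram-z ram-z′ x∈c x∈c′ unram-x with z ≟ᶠ z′
  ... | yes z≡z′ = z≡z′
  ... | no z≢z′ with splitAt (proj₁ cp) x∈c | splitAt (proj₁ cp′) x∈c′
  ... | c₁ , _ , c≡ , ch₁ , _ | c₁′ , _ , c′≡ , ch₁′ , _
    with splice ram-z ram-z′ z≢z′ ch₁ (Chain-reverse ch₁′) (closedPath-prefix-onlyRamified cp c≡)
                (closedPath-prefix-onlyRamified cp′ c′≡ ∘ ∈verts-reverse⁻ ch₁′)
  ... | rs , r , (g , g∈rs , g∈c₁) , _ =
    ⊥-elim (Unique-verts⇒o≢t chain unique g∈rs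
              (closedPath-edge∈2seg⇒loop cp (subst (g ∈_) (sym c≡) (∈-++⁺ˡ g∈c₁))
                 (segmentOf z z′ (rs , r) , segmentOf-Is2Seg z z′ (rs , r) ,
                  edgeOn⇒∈segmentOf z z′ (rs , r) (∈⇒edgeOn g∈rs))))
    where open Admissible′ (toAdmissible′ r)

  -- A walk on from u stays on closed paths at v (closedPaths-meet⇒sameBase), so it meets
  -- no ramified vertex before returning to v.
  trapped : ∀ {v c u es y} → Ram G v → ClosedPath G v c → u ∈ verts G v c → Unram G u → ¬ VertIn2Seg G u →
            Chain G u es y → Ram G y → v ∉ map t es → ⊥
  trapped ram-v cp u∈c unram-u free-u nil ram-y _ = unram-u ram-y
  trapped ram-v cp u∈c unram-u free-u (cons {e = e} oe c) ram-y v∉ with edgeIn2Seg⊎onClosedPath e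
  ... | inj₁ (A , isA , e∈A) = free-u (A , isA , e , e∈A , oe)
  ... | inj₂ (z′ , ram-z′ , c′ , cp′ , on′) with edgeOn⇒ends∈verts (proj₁ cp′) on′
  ... | oe∈c′ , te∈c′ with closedPaths-meet⇒sameBase cp cp′ ram-v ram-z′ u∈c (subst (_∈ _) oe oe∈c′) unram-u
  ... | refl with closedPath-vertex cp′ te∈c′
  ...   | inj₁ te≡v = v∉ (here (sym te≡v))
  ...   | inj₂ (unram-te , free-te) = trapped ram-v cp′ te∈c′ unram-te free-te c ram-y (v∉ ∘ there)

  firstEdge∈2seg : ∀ {v e es y} → Chain G v (e ∷ es) y → Unique (verts G v (e ∷ es)) → Ram G v → Ram G y →
                   EdgeIn2Seg G e
  firstEdge∈2seg {e = e} (cons oe c) (v∉ ∷ _) ram-v ram-y with edgeIn2Seg⊎onClosedPath e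
  ... | inj₁ in2Seg = in2Seg
  ... | inj₂ (z , ram-z , _ , cp , on) with edgeOn⇒ends∈verts (proj₁ cp) on
  ... | oe∈ , te∈ with closedPath-vertex cp oe∈ | closedPath-vertex cp te∈
  ... | inj₂ (unram-oe , _) | _ = ⊥-elim (unram-oe (subst (Ram G) (sym oe) ram-v))
  ... | inj₁ oe≡z | inj₁ te≡z = ⊥-elim (All.lookup v∉ (here refl) (trans (sym oe) (trans oe≡z (sym te≡z))))
  ... | inj₁ refl | inj₂ (unram-te , free-te) =
    ⊥-elim (trapped ram-z cp te∈ unram-te free-te c ram-y (λ oe∈ → All.lookup v∉ (there (subst (_∈ _) oe oe∈)) refl))

module SpanningTree (G : Graph) (SD : HasSegmentDecomposition G) (T : Subset (Graph.nE G))
                    (spanning : IsSpanningTree G T) where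
  open Graph G
  open Walks G
  open Admissibility G
  open SegmentDecomposition G SD
  open import Data.List.Membership.DecPropositional (_≟ᶠ_ {nV}) using () renaming (_∈?_ to _∈ᵛ?_)

  bar∈T : ∀ {e} → e ∈ₛ T → bar e ∈ₛ T
  bar∈T = proj₁ (proj₂ spanning) _

  connected : ∀ u w → Star (Adj G T) u w
  connected u w = proj₁ (proj₂ (proj₂ (proj₂ spanning))) u w tt tt

  acyclic : ¬ HasCycle G T
  acyclic = proj₂ (proj₂ (proj₂ (proj₂ spanning)))

  TreeSegment : Subset nE → Set
  TreeSegment A = Is2Seg G A × IsTree G (VertOf G A) (A ∩ T)

  sameFirstEdge∈ : ∀ {A x e es f fs y} → (∀ {g} → g ∈ₛ A → bar g ∈ₛ A) →
    Chain G x (e ∷ es) y → Chain G x (f ∷ fs) y → All (_∈ₛ T) (e ∷ es) → All (_∈ₛ T) (f ∷ fs) →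
    x ∉ map t (e ∷ es) → x ∉ map t (f ∷ fs) → e ∈ₛ A → f ∈ₛ A
  sameFirstEdge∈ bar∈A c₁ c₂ T₁ T₂ x∉₁ x∉₂ e∈A with acyclic⇒sameFirstEdge bar∈T acyclic c₁ c₂ T₁ T₂ x∉₁ x∉₂
  ... | inj₁ refl = e∈A
  ... | inj₂ refl = bar∈A e∈A

  module _ {A : Subset nE} (isA : Is2Seg G A) where
    open TwoSegment isA

    adj-sym : ∀ {x y} → Adj G (A ∩ T) x y → Adj G (A ∩ T) y x
    adj-sym (e , e∈ , oe , te) with x∈p∩q⁻ A T e∈
    ... | e∈A , e∈T = bar e , x∈p∩q⁺ (bar∈ e∈A , bar∈T e∈T) , trans (o-bar e) te , trans (t-bar e) oe

    reachEnd-within : ∀ {u} → VertOf G A u → ∃ λ z → IsEnd z × Star (Adj G (A ∩ T)) u z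
    reachEnd-within {u} u∈A with ram? u
    ... | yes ram-u = u , ramified⇒end u∈A ram-u , ε
    ... | no unram-u with star⇒chain (connected u a)
    ...   | [] , c , _ = ⊥-elim (unram-u (subst (Ram G) (sym (Chain[]⇒≡ c)) ram-a))
    ...   | e ∷ es , c , es⊆T with reachEnd isA c (edge-at-unramified∈ isA u∈A unram-u (Chain-o c)) ram-a es⊆T
    ...     | z , z-end , _ , u↝z = z , z-end , u↝z

    endsConnected⇒IsTree : Star (Adj G (A ∩ T)) a b → IsTree G (VertOf G A) (A ∩ T)
    endsConnected⇒IsTree a↝b =
      (a , a∈VertOf) ,
      (λ e e∈ → let e∈A , e∈T = x∈p∩q⁻ A T e∈ in x∈p∩q⁺ (bar∈ e∈A , bar∈T e∈T)) ,
      (λ e e∈ → e , proj₁ (x∈p∩q⁻ A T e∈) , refl) ,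
      connect ,
      λ (x , es , c , len , es⊆ , d , u) → acyclic (x , es , c , len , All.map (proj₂ ∘ x∈p∩q⁻ A T) es⊆ , d , u)
      where
      connect : ∀ u w → VertOf G A u → VertOf G A w → Star (Adj G (A ∩ T)) u w
      connect u w u∈A w∈A with reachEnd-within u∈A | reachEnd-within w∈A
      ... | z , z-end , u↝z | z′ , z′-end , w↝z′ =
        u↝z ◅◅ ends-linked adj-sym a↝b z-end z′-end ◅◅ Star.reverse adj-sym w↝z′

  module Rooted (r₀ : Fin nV) (ram-r₀ : Ram G r₀) where

    TreePath : Fin nV → List (Fin nE) → Set
    TreePath v es = Chain G v es r₀ × Unique (verts G v es) × All (_∈ₛ T) es

    treePath : ∀ v → Σ (List (Fin nE)) (TreePath v)
    treePath v = star⇒uniqueChain (connected v r₀)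

    -- Subset.⊥ is a junk value: the tree path from r₀ is empty, and from any other ramified
    -- vertex it starts with an edge of a 2-segment (firstEdge∈2seg).
    segmentOfDec : ∀ {e} → Dec (EdgeIn2Seg G e) → Subset nE
    segmentOfDec (yes (A , _)) = A
    segmentOfDec (no _) = Subset.⊥

    firstSegment : List (Fin nE) → Subset nE
    firstSegment [] = Subset.⊥
    firstSegment (e ∷ _) = segmentOfDec (edgeIn2Seg? e)

    segmentAt : Fin nV → Subset nE
    segmentAt v = firstSegment (proj₁ (treePath v))

    firstSegment-spec : ∀ {v e es} → TreePath v (e ∷ es) → Ram G v →
                        Is2Seg G (firstSegment (e ∷ es)) × e ∈ₛ firstSegment (e ∷ es)
    firstSegment-spec {e = e} (c , u , _) ram-v = spec (edgeIn2Seg? e)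
      where
      spec : (d : Dec (EdgeIn2Seg G e)) → Is2Seg G (segmentOfDec d) × e ∈ₛ segmentOfDec d
      spec (yes (_ , isA , e∈A)) = isA , e∈A
      spec (no ¬in2Seg) = ⊥-elim (¬in2Seg (firstEdge∈2seg c u ram-v ram-r₀))

    firstSegment-≡ : ∀ {v f fs A} → TreePath v (f ∷ fs) → Ram G v → Is2Seg G A → f ∈ₛ A → firstSegment (f ∷ fs) ≡ A
    firstSegment-≡ P ram-v isA f∈A with firstSegment-spec P ram-v
    ... | isB , f∈B = Is2Seg-≡ isB isA f∈B f∈A

    firstSegment-isTree : ∀ {v es} → TreePath v es → Ram G v → v ≢ r₀ →
      Is2Seg G (firstSegment es) × IsTree G (VertOf G (firstSegment es)) (firstSegment es ∩ T)
    firstSegment-isTree {es = []} (c , _) _ v≢r₀ = ⊥-elim (v≢r₀ (Chain[]⇒≡ c))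
    firstSegment-isTree {v} {e ∷ es} P@(c , u , es⊆T) ram-v _ with firstSegment-spec P ram-v
    ... | isA , e∈A with reachEnd isA c e∈A ram-r₀ es⊆T
    ... | z , z-end , z∈ , v↝z =
      isA , endsConnected⇒IsTree isA
              (distinct-ends-linked (adj-sym isA) (ramified⇒end (e , e∈A , Chain-o c) ram-v) z-end v≢z v↝z)
      where
      open TwoSegment isA
      v≢z : v ≢ z
      v≢z refl = Unique[x∷xs]⇒x∉xs u z∈

    module _ {A : Subset nE} (isA : Is2Seg G A) where
      open TwoSegment isA

      otherEnd∈path : ∀ {v v′ e es} → TreePath v′ (e ∷ es) → e ∈ₛ A → IsEnd v → IsEnd v′ → v ≢ v′ → v ∈ map t (e ∷ es)
      otherEnd∈path (c , u , es⊆T) e∈A v-end v′-end v≢v′ with reachEnd isA c e∈A ram-r₀ es⊆T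
      ... | z , z-end , z∈ , _ with distinct-ends-cover v-end v′-end v≢v′ z-end
      ... | inj₁ refl = z∈
      ... | inj₂ refl = ⊥-elim (Unique[x∷xs]⇒x∉xs u z∈)

      -- The part of the path from v′ beyond v would start in A by acyclicity,
      -- and so would reach v or v′ a second time.
      end∈path⇒⊥ : ∀ {v v′ e es es′} → TreePath v (e ∷ es) → TreePath v′ es′ → e ∈ₛ A →
        IsEnd v → IsEnd v′ → v ≢ v′ → v ≢ r₀ → v ∈ map t es′ → ⊥
      end∈path⇒⊥ {v} {v′} (c , u , es⊆T) (c′ , u′ , es′⊆T) e∈A v-end v′-end v≢v′ v≢r₀ v∈
        with splitAt c′ (there v∈)
      ... | pre , [] , _ , _ , c-post = v≢r₀ (Chain[]⇒≡ c-post)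
      ... | pre , f ∷ post , refl , c-pre , c-post =
        beyond (subst Unique (verts-++ v′ pre (f ∷ post)) u′) (All.tabulate (All.lookup es′⊆T ∘ ∈-++⁺ʳ pre))
        where
        beyond : Unique (verts G v′ pre ++ map t (f ∷ post)) → All (_∈ₛ T) (f ∷ post) → ⊥
        beyond split-unique post⊆T
          with reachEnd isA c-post (sameFirstEdge∈ bar∈ c c-post es⊆T post⊆T (Unique[x∷xs]⇒x∉xs u) v∉post e∈A)
                 ram-r₀ post⊆T
          where
          v∉post : v ∉ map t (f ∷ post)
          v∉post = Unique-++⇒disjoint (verts G v′ pre) split-unique (end∈verts c-pre)
        ... | z , z-end , z∈ , _ with distinct-ends-cover v-end v′-end v≢v′ z-end
        ... | inj₁ refl = Unique-++⇒disjoint (verts G v′ pre) split-unique (end∈verts c-pre) z∈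
        ... | inj₂ refl = Unique-++⇒disjoint (verts G v′ pre) split-unique (here refl) z∈

    firstSegment-injective : ∀ {v v′ es es′} → TreePath v es → TreePath v′ es′ → Ram G v → Ram G v′ →
      v ≢ r₀ → v′ ≢ r₀ → firstSegment es ≡ firstSegment es′ → v ≡ v′
    firstSegment-injective {es = []} (c , _) _ _ _ v≢r₀ _ _ = ⊥-elim (v≢r₀ (Chain[]⇒≡ c))
    firstSegment-injective {es′ = []} _ (c′ , _) _ _ _ v′≢r₀ _ = ⊥-elim (v′≢r₀ (Chain[]⇒≡ c′))
    firstSegment-injective {v} {v′} {e ∷ es} {e′ ∷ es′} P P′ ram-v ram-v′ v≢r₀ _ same with v ≟ᶠ v′
    ... | yes v≡v′ = v≡v′
    ... | no v≢v′ with firstSegment-spec P ram-v | firstSegment-spec P′ ram-v′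
    ... | isA , e∈A | _ , e′∈A′ =
      ⊥-elim (end∈path⇒⊥ isA P P′ e∈A v-end v′-end v≢v′ v≢r₀ (otherEnd∈path isA P′ e′∈A v-end v′-end v≢v′))
      where
      open TwoSegment isA
      e′∈A : e′ ∈ₛ firstSegment (e ∷ es)
      e′∈A = subst (e′ ∈ₛ_) (sym same) e′∈A′
      v-end : IsEnd v
      v-end = ramified⇒end (e , e∈A , Chain-o (proj₁ P)) ram-v
      v′-end : IsEnd v′
      v′-end = ramified⇒end (e′ , e′∈A , Chain-o (proj₁ P′)) ram-v′

    module _ {A : Subset nE} (isA : Is2Seg G A) where
      open TwoSegment isA

      InnerPath : Fin nV → Fin nV → List (Fin nE) → Set
      InnerPath x y qs = Chain G x qs y × Unique (verts G x qs) × All (_∈ₛ A ∩ T) qs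

      inner⊆A : ∀ {qs} → All (_∈ₛ A ∩ T) qs → ∀ {q} → q ∈ qs → q ∈ₛ A
      inner⊆A qs⊆ = proj₁ ∘ x∈p∩q⁻ A T ∘ All.lookup qs⊆

      inner⊆T : ∀ {qs} → All (_∈ₛ A ∩ T) qs → All (_∈ₛ T) qs
      inner⊆T = All.map (proj₂ ∘ x∈p∩q⁻ A T)

      -- If a lies on the tree path from b, that path starts like the path from b to a inside A.
      a∈path⇒firstSegment[b] : ∀ {es qs} → TreePath b es → a ∈ map t es → InnerPath b a qs →
                               b ≢ r₀ × firstSegment es ≡ A
      a∈path⇒firstSegment[b] {[]} _ ()
      a∈path⇒firstSegment[b] {_ ∷ _} {[]} _ _ (cq , _) = ⊥-elim (a≢b (sym (Chain[]⇒≡ cq)))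
      a∈path⇒firstSegment[b] {f ∷ fs} {q ∷ qs} P@(c , u , es⊆T) a∈ (cq , uq , qs⊆) with splitAt c (there a∈)
      ... | [] , _ , _ , c-pre , _ = ⊥-elim (a≢b (sym (Chain[]⇒≡ c-pre)))
      ... | f ∷ pre , post , refl , c-pre , _ =
        b≢r₀ , firstSegment-≡ P ram-b isA
                 (sameFirstEdge∈ bar∈ cq c-pre (inner⊆T qs⊆) (++⁻ˡ (f ∷ pre) es⊆T) (Unique[x∷xs]⇒x∉xs uq) b∉pre
                    (inner⊆A qs⊆ (here refl)))
        where
        b∉pre : b ∉ map t (f ∷ pre)
        b∉pre b∈ = Unique[x∷xs]⇒x∉xs u (subst (b ∈_) (sym (map-++ t (f ∷ pre) post)) (∈-++⁺ˡ b∈))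
        b≢r₀ : b ≢ r₀
        b≢r₀ b≡r₀ = Unique[x∷xs]⇒x∉xs u (subst (_∈ _) (sym b≡r₀) (end∈targets c))

      a∉path⇒a≢r₀ : ∀ {es} → TreePath b es → a ∉ map t es → a ≢ r₀
      a∉path⇒a≢r₀ (c , _) a∉ a≡r₀ with end∈targets⊎≡start c
      ... | inj₁ r₀∈ = a∉ (subst (_∈ _) (sym a≡r₀) r₀∈)
      ... | inj₂ b≡r₀ = a≢b (trans a≡r₀ (sym b≡r₀))

      -- If a is not on the tree path from b, the path from a to b inside A followed by that
      -- tree path avoids a, so the tree path from a starts with the same edge.
      a∉path⇒firstSegment[a] : ∀ {es esₐ qs} → TreePath b es → a ∉ map t es → TreePath a esₐ → InnerPath a b qs →
                               firstSegment esₐ ≡ A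
      a∉path⇒firstSegment[a] {esₐ = []} P a∉ (cₐ , _) _ = ⊥-elim (a∉path⇒a≢r₀ P a∉ (Chain[]⇒≡ cₐ))
      a∉path⇒firstSegment[a] {qs = []} _ _ _ (cq , _) = ⊥-elim (a≢b (Chain[]⇒≡ cq))
      a∉path⇒firstSegment[a] {es} {f ∷ fs} {q ∷ qs} (c , _ , es⊆T) a∉ Pₐ@(cₐ , uₐ , esₐ⊆T) (cq , uq , qs⊆) =
        firstSegment-≡ Pₐ ram-a isA
          (sameFirstEdge∈ bar∈ (Chain-++ cq c) cₐ (++⁺ (inner⊆T qs⊆) es⊆T) esₐ⊆T a∉qs++es (Unique[x∷xs]⇒x∉xs uₐ)
             (inner⊆A qs⊆ (here refl)))
        where
        a∉qs++es : a ∉ map t ((q ∷ qs) ++ es)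
        a∉qs++es a∈ with ∈-++⁻ (map t (q ∷ qs)) (subst (a ∈_) (map-++ t (q ∷ qs) es) a∈)
        ... | inj₁ a∈qs = Unique[x∷xs]⇒x∉xs uq a∈qs
        ... | inj₂ a∈es = a∉ a∈es

      innerPath : IsTree G (VertOf G A) (A ∩ T) → ∀ {x y} → VertOf G A x → VertOf G A y → ∃ (InnerPath x y)
      innerPath tree x∈A y∈A = star⇒uniqueChain (proj₁ (proj₂ (proj₂ (proj₂ tree))) _ _ x∈A y∈A)

      segmentAt-surjective : IsTree G (VertOf G A) (A ∩ T) → ∃ λ v → Ram G v × v ≢ r₀ × segmentAt v ≡ A
      segmentAt-surjective tree with a ∈ᵛ? map t (proj₁ (treePath b))
      ... | yes a∈ =
        b , ram-b , a∈path⇒firstSegment[b] (proj₂ (treePath b)) a∈ (proj₂ (innerPath tree b∈VertOf a∈VertOf))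
      ... | no a∉ =
        a , ram-a , a∉path⇒a≢r₀ (proj₂ (treePath b)) a∉ ,
        a∉path⇒firstSegment[a] (proj₂ (treePath b)) a∉ (proj₂ (treePath a)) (proj₂ (innerPath tree a∈VertOf b∈VertOf))

    count : HasCard G TreeSegment (numRam G ∸ 1)
    count with enumerate-surjective ramified ram-r₀
    ... | i₀ , vertex[i₀]≡r₀ = hasCard-punctured G (segmentAt ∘ vertex) i₀
      (λ {i} i≢i₀ → firstSegment-isTree (path i) (ram i) (≢r₀ i≢i₀))
      (λ i≢i₀ j≢i₀ same → enumerate-injective ramified
         (firstSegment-injective (path _) (path _) (ram _) (ram _) (≢r₀ i≢i₀) (≢r₀ j≢i₀) same))
      surjective
      where
      vertex : Fin ∣ ramified ∣ → Fin nV
      vertex = enumerate ramified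
      path : ∀ i → TreePath (vertex i) (proj₁ (treePath (vertex i)))
      path i = proj₂ (treePath (vertex i))
      ram : ∀ i → Ram G (vertex i)
      ram = enumerate-∈ ramified
      ≢r₀ : ∀ {i} → i ≢ i₀ → vertex i ≢ r₀
      ≢r₀ i≢i₀ vertex[i]≡r₀ = i≢i₀ (enumerate-injective ramified (trans vertex[i]≡r₀ (sym vertex[i₀]≡r₀)))
      surjective : ∀ A → TreeSegment A → ∃ λ i → i ≢ i₀ × segmentAt (vertex i) ≡ A
      surjective A (isA , tree) with segmentAt-surjective isA tree
      ... | v , ram-v , v≢r₀ , segmentAt[v]≡A with enumerate-surjective ramified ram-v
      ... | i , refl = i , (λ { refl → v≢r₀ vertex[i₀]≡r₀ }) , segmentAt[v]≡A

  count-unramified : Subset.Empty ramified → HasCard G TreeSegment (numRam G ∸ 1)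
  count-unramified none =
    subst (λ l → HasCard G TreeSegment (l ∸ 1)) (sym (trans (cong ∣_∣ (Empty-unique none)) (∣⊥∣≡0 nV)))
      ((λ ()) , (λ ()) , (λ ()) , λ A (isA , _) → ⊥-elim (none (_ , TwoSegment.ram-a isA)))

-- The spanning tree provides connectivity, and the count does not need the absence of tails.
lemma5p10 : (G : Graph) → Connected G → NoTails G → HasSegmentDecomposition G →
    (T : Subset (Graph.nE G)) → IsSpanningTree G T →
    HasCard G (λ A → Is2Seg G A × IsTree G (VertOf G A) (A ∩ T)) (numRam G ∸ 1)
lemma5p10 G _ _ SD T spanning with nonempty? (Graph.ramified G)
... | yes (r₀ , ram-r₀) = SpanningTree.Rooted.count G SD T spanning r₀ ram-r₀
... | no none = SpanningTree.count-unramified G SD T spanning none
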